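{- Differential equivalence $\sim_\epsilon$ of unrestricted $\lambda_\epsilon$-terms is decidable: there is an algorithm which, given two unrestricted terms $s,t$, decides whether $s \sim_\epsilon t$.
   Context: Unrestricted terms of the $\lambda_\epsilon$-calculus are generated by the grammar $t ::= x \mid \lambda x.t \mid (s\ t) \mid \mathsf{D}(s)\cdot t \mid \epsilon t \mid s+t \mid 0$, over a countably infinite set of variables. $\lambda$ is the only binder; free variables are defined as usual, and terms are considered up to $\alpha$-equivalence. A binary relation $\sim$ on terms is contextual if $t\sim t'$ implies $\lambda x.t\sim\lambda x.t'$ and $\epsilon t\sim\epsilon t'$, and $s\sim s'$, $t\sim t'$ imply $(s\ t)\sim(s'\ t')$, $\mathsf{D}(s)\cdot t\sim\mathsf{D}(s')\cdot t'$ and $s+t\sim s'+t'$. We write $\epsilon^k t$ for $k$-fold application of $\epsilon$ ($\epsilon^0 t=t$). Differential equivalence $\sim_\epsilon$ is the least contextual equivalence relation containing the following pairs (for all terms $s,t,e$ and variables $x$): $(s+t)+e\sim s+(t+e)$; $s+0\sim s$; $s+t\sim t+s$; $\epsilon 0\sim 0$; $\epsilon(s+t)\sim\epsilon s+\epsilon t$; $\lambda x.0\sim 0$; $\lambda x.(s+t)\sim(\lambda x.s)+(\lambda x.t)$; $\lambda x.\epsilon t\sim\epsilon(\lambda x.t)$; $(0\ s)\sim 0$; $((s+t)\ e)\sim(s\ e)+(t\ e)$; $((\epsilon s)\ t)\sim\epsilon(s\ t)$; $\mathsf{D}(0)\cdot e\sim 0$; $\mathsf{D}(s+t)\cdot e\sim(\mathsf{D}(s)\cdot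 e)+(\mathsf{D}(t)\cdot e)$; $\mathsf{D}(\epsilon t)\cdot e\sim\epsilon(\mathsf{D}(t)\cdot e)$; $\mathsf{D}(s)\cdot 0\sim 0$; $\mathsf{D}(s)\cdot(t+e)\sim\mathsf{D}(s)\cdot t+\mathsf{D}(s)\cdot e+\epsilon(\mathsf{D}(\mathsf{D}(s)\cdot t)\cdot e)$; $\mathsf{D}(s)\cdot(\epsilon t)\sim\epsilon(\mathsf{D}(s)\cdot t)$; $\mathsf{D}(\mathsf{D}(s)\cdot t)\cdot e\sim\mathsf{D}(\mathsf{D}(s)\cdot e)\cdot t$; $\epsilon^2(\mathsf{D}(\mathsf{D}(s)\cdot t)\cdot e)\sim\epsilon(\mathsf{D}(\mathsf{D}(s)\cdot t)\cdot e)$; $(s\ (t+\epsilon e))\sim(s\ t)+\epsilon((\mathsf{D}(s)\cdot e)\ t)$. -}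

module Defs where

open import Data.Nat using (ℕ; suc)

-- Unrestricted λε-terms, with de Bruijn indices (terms up to α-equivalence).
-- Variables range over ℕ (a countably infinite set); `lam` is the only binder.
data Term : Set where
  var : ℕ → Term
  lam : Term → Term
  app : Term → Term → Term
  D   : Term → Term → Term
  eps : Term → Term
  _⊕_ : Term → Term → Term
  𝟘   : Term

infixl 6 _⊕_

eps^ : ℕ → Term → Term
eps^ 0 t = t
eps^ (suc k) t = eps (eps^ k t)

infix 4 _∼ε_
data _∼ε_ : Term → Term → Set where
  ∼refl  : ∀ {s} → s ∼ε s
  ∼sym   : ∀ {s t} → s ∼ε t → t ∼ε s
  ∼trans : ∀ {s t e} → s ∼ε t → t ∼ε e → s ∼ε e
  c-lam : ∀ {t t'} → t ∼ε t' → lam t ∼ε lam t'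
  c-eps : ∀ {t t'} → t ∼ε t' → eps t ∼ε eps t'
  c-app : ∀ {s s' t t'} → s ∼ε s' → t ∼ε t' → app s t ∼ε app s' t'
  c-D   : ∀ {s s' t t'} → s ∼ε s' → t ∼ε t' → D s t ∼ε D s' t'
  c-+   : ∀ {s s' t t'} → s ∼ε s' → t ∼ε t' → s ⊕ t ∼ε s' ⊕ t'
  ax-+assoc  : ∀ {s t e} → (s ⊕ t) ⊕ e ∼ε s ⊕ (t ⊕ e)
  ax-+0      : ∀ {s} → s ⊕ 𝟘 ∼ε s
  ax-+comm   : ∀ {s t} → s ⊕ t ∼ε t ⊕ s
  ax-ε0      : eps 𝟘 ∼ε 𝟘
  ax-ε+      : ∀ {s t} → eps (s ⊕ t) ∼ε eps s ⊕ eps t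
  ax-λ0      : lam 𝟘 ∼ε 𝟘
  ax-λ+      : ∀ {s t} → lam (s ⊕ t) ∼ε lam s ⊕ lam t
  ax-λε      : ∀ {t} → lam (eps t) ∼ε eps (lam t)
  ax-app0    : ∀ {s} → app 𝟘 s ∼ε 𝟘
  ax-app+    : ∀ {s t e} → app (s ⊕ t) e ∼ε app s e ⊕ app t e
  ax-appε    : ∀ {s t} → app (eps s) t ∼ε eps (app s t)
  ax-D0l     : ∀ {e} → D 𝟘 e ∼ε 𝟘
  ax-D+l     : ∀ {s t e} → D (s ⊕ t) e ∼ε D s e ⊕ D t e
  ax-Dεl     : ∀ {t e} → D (eps t) e ∼ε eps (D t e)
  ax-D0r     : ∀ {s} → D s 𝟘 ∼ε 𝟘
  ax-D+r     : ∀ {s t e} → D s (t ⊕ e) ∼ε D s t ⊕ D s e ⊕ eps (D (D s t) e)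
  ax-Dεr     : ∀ {s t} → D s (eps t) ∼ε eps (D s t)
  ax-DDswap  : ∀ {s t e} → D (D s t) e ∼ε D (D s e) t
  ax-ε2DD    : ∀ {s t e} → eps^ 2 (D (D s t) e) ∼ε eps (D (D s t) e)
  ax-appTaylor : ∀ {s t e} → app s (t ⊕ eps e) ∼ε app s t ⊕ eps (app (D s e) t)

-- Every term is ∼ε-equivalent to a finite sum of ε-graded monomials εᵏ m, where a
-- monomial is a variable, an abstraction, a monomial applied to a sum of ε-free
-- monomials, or an iterated derivative D(⋯D(h)·a₁⋯)·aₙ, and where the summands of
-- an argument and the derivation directions are taken up to order. The denotation
-- ⟦ t ⟧ computes such a sum by orienting the axioms: sums and ε move outwards
-- through linear positions, ax-D+r expands a derivative along a sum (Leibniz rule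
-- with an ε-weighted cross term) and ax-appTaylor splits an argument into its
-- ε-free and its ε-divisible part. Every axiom but ax-ε2DD then holds on
-- denotations up to permutation; ax-ε2DD holds once all positive ε-powers of a
-- monomial with a double derivative in a linear position are identified. Hence
-- the sorted collapsed denotation is invariant under ∼ε; as every term is
-- equivalent to its reading-back, this is a normal form, and ∼ε is decided by
-- comparing normal forms.

module Submission where

open import Defs
import Algebra.Solver.CommutativeMonoid as CommutativeMonoidSolver
open import Data.Bool using (Bool; true; false; _∨_)
open import Data.Bool.Properties using (∨-assoc; ∨-comm; ∨-zeroʳ)
open import Data.List using (List; []; _∷_; _++_; map; concatMap; length; [_]; mapMaybe)
import Data.List.Properties as List
import Data.List.Relation.Binary.Lex.NonStrict as Lex
import Data.List.Relation.Binary.Permutation.Propositional as Perm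
open Perm using (_↭_; prep; swap; ↭-refl; ↭-sym; ↭-trans; ↭-reflexive; ↭⇒↭ₛ′)
open import Data.List.Relation.Binary.Permutation.Propositional.Properties
  using (++⁺; ++⁺ˡ; shifts; map⁺; ++-comm; ∷↭∷ʳ; ++-commutativeMonoid; ↭-length; mapMaybe-↭)
import Data.List.Relation.Binary.Pointwise as Pointwise
open Pointwise using (Pointwise; []; _∷_)
open import Data.List.Relation.Unary.All using (All; []; _∷_)
import Data.List.Relation.Unary.All.Properties as All
import Data.List.Relation.Unary.Sorted.TotalOrder.Properties as Sorted
import Data.List.Sort as Sort
open import Data.Maybe using (Maybe; just; nothing)
open import Data.Nat using (ℕ; zero; suc; _+_; _<ᵇ_)
import Data.Nat.Properties as ℕ
open import Data.Product using (_×_; _,_; proj₁; proj₂; map₁; map₂)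
open import Function using (_∘_)
open import Function.Definitions using (Injective)
open import Relation.Binary.Bundles using (DecTotalOrder)
import Relation.Binary.Construct.On as On
open import Relation.Binary.Definitions using (DecidableEquality)
open import Relation.Binary.PropositionalEquality
  using (_≡_; refl; sym; trans; cong; cong₂; module ≡-Reasoning)
open import Relation.Nullary using (Dec)
open import Relation.Nullary.Decidable using (map′)

private variable
  A B : Set

concatMap⁺ : (f : A → List B) {xs ys : List A} → xs ↭ ys → concatMap f xs ↭ concatMap f ys
concatMap⁺ f Perm.refl = ↭-refl
concatMap⁺ f (prep x p) = ++⁺ˡ (f x) (concatMap⁺ f p)
concatMap⁺ f (swap x y p) = ↭-trans (shifts (f x) (f y)) (++⁺ˡ (f y) (++⁺ˡ (f x) (concatMap⁺ f p)))
concatMap⁺ f (Perm.trans p q) = ↭-trans (concatMap⁺ f p) (concatMap⁺ f q)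

concatMap-cong-↭ : {f g : A → List B} → (∀ x → f x ↭ g x) →
                   ∀ xs → concatMap f xs ↭ concatMap g xs
concatMap-cong-↭ f↭g [] = ↭-refl
concatMap-cong-↭ f↭g (x ∷ xs) = ++⁺ (f↭g x) (concatMap-cong-↭ f↭g xs)

concatMap-++-distrib : (f g : A → List B) → ∀ xs →
                       concatMap (λ x → f x ++ g x) xs ↭ concatMap f xs ++ concatMap g xs
concatMap-++-distrib f g [] = ↭-refl
concatMap-++-distrib f g (x ∷ xs) = begin
  (f x ++ g x) ++ concatMap (λ x → f x ++ g x) xs
    ≡⟨ List.++-assoc (f x) (g x) _ ⟩
  f x ++ g x ++ concatMap (λ x → f x ++ g x) xs
    ↭⟨ ++⁺ˡ (f x) (++⁺ˡ (g x) (concatMap-++-distrib f g xs)) ⟩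
  f x ++ g x ++ concatMap f xs ++ concatMap g xs
    ↭⟨ ++⁺ˡ (f x) (shifts (g x) (concatMap f xs)) ⟩
  f x ++ concatMap f xs ++ g x ++ concatMap g xs
    ≡⟨ List.++-assoc (f x) _ _ ⟨
  (f x ++ concatMap f xs) ++ g x ++ concatMap g xs ∎
  where open Perm.PermutationReasoning

mapMaybe-≗⁺ : ∀ {F : List A → List B} (f : A → Maybe B) → (∀ xs → F xs ≡ mapMaybe f xs) →
              ∀ {xs ys} → xs ↭ ys → F xs ↭ F ys
mapMaybe-≗⁺ f F≗ {xs} {ys} p =
  ↭-trans (↭-reflexive (F≗ xs)) (↭-trans (mapMaybe-↭ f p) (↭-reflexive (sym (F≗ ys))))

-- An injective encoding into lexicographically ordered `List ℕ` makes the
-- sorted permutation of a list a canonical representative of its multiset.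
module SortBy (encode : A → List ℕ) (encode-injective : Injective _≡_ _≡_ encode) where

  order : DecTotalOrder _ _ _
  order = On.decTotalOrder (Lex.≤-decTotalOrder ℕ.≤-decTotalOrder) encode

  open Sort order public using (sort; sort-↭; sort-↗)
  open DecTotalOrder order using (totalOrder; isEquivalence)

  ↭⇒sort-≡ : {xs ys : List A} → xs ↭ ys → sort xs ≡ sort ys
  ↭⇒sort-≡ {xs} {ys} xs↭ys =
    Pointwise.Pointwise-≡⇒≡ (Pointwise.map (encode-injective ∘ Pointwise.Pointwise-≡⇒≡)
      (Sorted.↗↭↗⇒≋ totalOrder (sort-↗ xs) (sort-↗ ys)
        (↭⇒↭ₛ′ isEquivalence (↭-trans (sort-↭ xs) (↭-trans xs↭ys (↭-sym (sort-↭ ys)))))))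

  _≟_ : DecidableEquality A
  x ≟ y = map′ encode-injective (cong encode) (List.≡-dec ℕ._≟_ (encode x) (encode y))

-- Normal forms

-- `mapp m P` is m applied to the sum of P, and `mD h S` is the iterated
-- derivative D(⋯D(h)·a₁⋯)·aₙ of a head h (never itself an `mD`) along the
-- list S = a₁ ⋯ aₙ. Both lists are kept sorted, which makes the order of
-- summands in an argument and of derivation directions immaterial.
data Monomial : Set where
  mvar : ℕ → Monomial
  mlam : Monomial → Monomial
  mapp : Monomial → List Monomial → Monomial
  mD   : Monomial → List Monomial → Monomial

-- (k , m) stands for εᵏ m; a normal form is a finite multiset of these.
Graded : Set
Graded = ℕ × Monomial

Poly : Set
Poly = List Graded

mutual
  encodeMonomial : Monomial → List ℕ → List ℕ
  encodeMonomial (mvar n)   r = 0 ∷ n ∷ r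
  encodeMonomial (mlam m)   r = 1 ∷ encodeMonomial m r
  encodeMonomial (mapp m P) r = 2 ∷ encodeMonomial m (encodeMonomials P r)
  encodeMonomial (mD m S)   r = 3 ∷ encodeMonomial m (encodeMonomials S r)

  encodeMonomials : List Monomial → List ℕ → List ℕ
  encodeMonomials []       r = 0 ∷ r
  encodeMonomials (m ∷ ms) r = 1 ∷ encodeMonomial m (encodeMonomials ms r)

mutual
  encodeMonomial-injective : ∀ m m′ {r r′} → encodeMonomial m r ≡ encodeMonomial m′ r′ →
                             m ≡ m′ × r ≡ r′
  encodeMonomial-injective (mvar n) (mvar .n) refl = refl , refl
  encodeMonomial-injective (mlam m) (mlam m′) eq
    with encodeMonomial-injective m m′ (List.∷-injectiveʳ eq)
  ... | refl , refl = refl , refl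
  encodeMonomial-injective (mapp m P) (mapp m′ P′) eq
    with encodeMonomial-injective m m′ (List.∷-injectiveʳ eq)
  ... | refl , eq′ with encodeMonomials-injective P P′ eq′
  ... | refl , refl = refl , refl
  encodeMonomial-injective (mD m S) (mD m′ S′) eq
    with encodeMonomial-injective m m′ (List.∷-injectiveʳ eq)
  ... | refl , eq′ with encodeMonomials-injective S S′ eq′
  ... | refl , refl = refl , refl
  encodeMonomial-injective (mvar _)   (mlam _)   ()
  encodeMonomial-injective (mvar _)   (mapp _ _) ()
  encodeMonomial-injective (mvar _)   (mD _ _)   ()
  encodeMonomial-injective (mlam _)   (mvar _)   ()
  encodeMonomial-injective (mlam _)   (mapp _ _) ()
  encodeMonomial-injective (mlam _)   (mD _ _)   ()
  encodeMonomial-injective (mapp _ _) (mvar _)   ()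
  encodeMonomial-injective (mapp _ _) (mlam _)   ()
  encodeMonomial-injective (mapp _ _) (mD _ _)   ()
  encodeMonomial-injective (mD _ _)   (mvar _)   ()
  encodeMonomial-injective (mD _ _)   (mlam _)   ()
  encodeMonomial-injective (mD _ _)   (mapp _ _) ()

  encodeMonomials-injective : ∀ ms ms′ {r r′} → encodeMonomials ms r ≡ encodeMonomials ms′ r′ →
                              ms ≡ ms′ × r ≡ r′
  encodeMonomials-injective [] [] refl = refl , refl
  encodeMonomials-injective (m ∷ ms) (m′ ∷ ms′) eq
    with encodeMonomial-injective m m′ (List.∷-injectiveʳ eq)
  ... | refl , eq′ with encodeMonomials-injective ms ms′ eq′
  ... | refl , refl = refl , refl
  encodeMonomials-injective [] (_ ∷ _) ()
  encodeMonomials-injective (_ ∷ _) [] ()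

encodeGraded : Graded → List ℕ
encodeGraded (k , m) = k ∷ encodeMonomial m []

encodeGraded-injective : Injective _≡_ _≡_ encodeGraded
encodeGraded-injective {k , m} {k′ , m′} eq with List.∷-injective eq
... | refl , eq′ with encodeMonomial-injective m m′ eq′
... | refl , _ = refl

module SortMonomials =
  SortBy (λ m → encodeMonomial m []) (λ {m} {m′} eq → proj₁ (encodeMonomial-injective m m′ eq))
module SortGraded = SortBy encodeGraded encodeGraded-injective

sortMonomials : List Monomial → List Monomial
sortMonomials = SortMonomials.sort

raise : ℕ → Poly → Poly
raise j = map (map₁ (j +_))

extendD : Monomial → Monomial → Monomial
extendD (mD h S) a = mD h (sortMonomials (a ∷ S))
extendD m        a = mD m [ a ]

-- D(m)·A, expanding a sum A by ax-D+r: each summand εᵏ a contributes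
-- εᵏ D(m)·a and, through the cross term, ε¹⁺ᵏ D(D(m)·a)·(rest of A).
Dₘ : Monomial → Poly → Poly
Dₘ m []            = []
Dₘ m ((k , a) ∷ A) = (k , extendD m a) ∷ (Dₘ m A ++ raise (suc k) (Dₘ (extendD m a) A))

purePart : Poly → List Monomial
purePart []                 = []
purePart ((zero  , m) ∷ A) = m ∷ purePart A
purePart ((suc _ , _) ∷ A) = purePart A

εPart : Poly → Poly
εPart []                 = []
εPart ((zero  , _) ∷ A) = εPart A
εPart ((suc k , m) ∷ A) = (k , m) ∷ εPart A

applyTo : List Monomial → Poly → Poly
applyTo P = map (map₂ (λ m → mapp m P))

-- (m A) by ax-appTaylor, writing A as purePart A + ε (εPart A).
appₘ : Monomial → Poly → Poly
appₘ m A = (0 , mapp m P) ∷ raise 1 (applyTo P (Dₘ m (εPart A)))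
  where P = sortMonomials (purePart A)

linear : (Monomial → Poly) → Poly → Poly
linear f = concatMap (λ (k , m) → raise k (f m))

Dₚ : Poly → Poly → Poly
Dₚ S T = linear (λ m → Dₘ m T) S

appₚ : Poly → Poly → Poly
appₚ S T = linear (λ m → appₘ m T) S

lamₚ : Poly → Poly
lamₚ = map (map₂ mlam)

⟦_⟧ : Term → Poly
⟦ var x ⟧   = [ (0 , mvar x) ]
⟦ lam t ⟧   = lamₚ ⟦ t ⟧
⟦ app s t ⟧ = appₚ ⟦ s ⟧ ⟦ t ⟧
⟦ D s t ⟧   = Dₚ ⟦ s ⟧ ⟦ t ⟧
⟦ eps t ⟧   = raise 1 ⟦ t ⟧
⟦ s ⊕ t ⟧   = ⟦ s ⟧ ++ ⟦ t ⟧
⟦ 𝟘 ⟧       = []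

raise-++ : ∀ j X Y → raise j (X ++ Y) ≡ raise j X ++ raise j Y
raise-++ j = List.map-++ (map₁ (j +_))

raise-raise : ∀ j k X → raise j (raise k X) ≡ raise (j + k) X
raise-raise j k [] = refl
raise-raise j k ((i , m) ∷ X) = cong₂ _∷_ (cong (_, m) (sym (ℕ.+-assoc j k i))) (raise-raise j k X)

raise-zero : ∀ X → raise 0 X ≡ X
raise-zero [] = refl
raise-zero (x ∷ X) = cong (x ∷_) (raise-zero X)

raise-comm : ∀ j k X → raise j (raise k X) ≡ raise k (raise j X)
raise-comm j k X = begin
  raise j (raise k X) ≡⟨ raise-raise j k X ⟩
  raise (j + k) X     ≡⟨ cong (λ i → raise i X) (ℕ.+-comm j k) ⟩
  raise (k + j) X     ≡⟨ raise-raise k j X ⟨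
  raise k (raise j X) ∎
  where open ≡-Reasoning

raise-applyTo : ∀ P j X → raise j (applyTo P X) ≡ applyTo P (raise j X)
raise-applyTo P j [] = refl
raise-applyTo P j (_ ∷ X) = cong (_ ∷_) (raise-applyTo P j X)

raise-lamₚ : ∀ j X → raise j (lamₚ X) ≡ lamₚ (raise j X)
raise-lamₚ j [] = refl
raise-lamₚ j (_ ∷ X) = cong (_ ∷_) (raise-lamₚ j X)

module _ (f : Monomial → Poly) where

  linear-++ : ∀ X Y → linear f (X ++ Y) ≡ linear f X ++ linear f Y
  linear-++ = List.concatMap-++ _

  linear-raise : ∀ j X → linear f (raise j X) ≡ raise j (linear f X)
  linear-raise j [] = refl
  linear-raise j ((k , m) ∷ X) = begin
    raise (j + k) (f m) ++ linear f (raise j X)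
      ≡⟨ cong₂ _++_ (sym (raise-raise j k (f m))) (linear-raise j X) ⟩
    raise j (raise k (f m)) ++ raise j (linear f X)
      ≡⟨ raise-++ j (raise k (f m)) _ ⟨
    raise j (raise k (f m) ++ linear f X) ∎
    where open ≡-Reasoning

  linear⁺ : {X Y : Poly} → X ↭ Y → linear f X ↭ linear f Y
  linear⁺ = concatMap⁺ _

  linear-inner-raise : ∀ j X → linear (raise j ∘ f) X ≡ raise j (linear f X)
  linear-inner-raise j X = begin
    linear (raise j ∘ f) X
      ≡⟨ List.concatMap-cong (λ (k , m) → raise-comm k j (f m)) X ⟩
    concatMap (λ (k , m) → raise j (raise k (f m))) X
      ≡⟨ List.map-concatMap (map₁ (j +_)) _ X ⟨
    raise j (linear f X) ∎
    where open ≡-Reasoning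

linear-linear : ∀ g f X → linear g (linear f X) ≡ linear (linear g ∘ f) X
linear-linear g f [] = refl
linear-linear g f ((k , m) ∷ X) = begin
  linear g (raise k (f m) ++ linear f X)
    ≡⟨ linear-++ g (raise k (f m)) _ ⟩
  linear g (raise k (f m)) ++ linear g (linear f X)
    ≡⟨ cong₂ _++_ (linear-raise g k (f m)) (linear-linear g f X) ⟩
  raise k (linear g (f m)) ++ linear (linear g ∘ f) X ∎
  where open ≡-Reasoning

linear-cong-↭ : ∀ {f g} → (∀ m → f m ↭ g m) → ∀ X → linear f X ↭ linear g X
linear-cong-↭ f↭g = concatMap-cong-↭ (λ (k , m) → map⁺ _ (f↭g m))

linear-++-distrib : ∀ f g X → linear (λ m → f m ++ g m) X ↭ linear f X ++ linear g X
linear-++-distrib f g X = ↭-trans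
  (↭-reflexive (List.concatMap-cong (λ (k , m) → raise-++ k (f m) (g m)) X))
  (concatMap-++-distrib _ _ X)

sort-swap : ∀ a b S → sortMonomials (a ∷ b ∷ S) ≡ sortMonomials (b ∷ a ∷ S)
sort-swap a b S = SortMonomials.↭⇒sort-≡ (swap a b ↭-refl)

sort-∷-sort : ∀ a S → sortMonomials (a ∷ sortMonomials S) ≡ sortMonomials (a ∷ S)
sort-∷-sort a S = SortMonomials.↭⇒sort-≡ (prep a (SortMonomials.sort-↭ S))

extendD-comm : ∀ m a b → extendD (extendD m a) b ≡ extendD (extendD m b) a
extendD-comm (mD h S) a b = cong (mD h) (begin
  sortMonomials (b ∷ sortMonomials (a ∷ S)) ≡⟨ sort-∷-sort b (a ∷ S) ⟩
  sortMonomials (b ∷ a ∷ S)                 ≡⟨ sort-swap b a S ⟩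
  sortMonomials (a ∷ b ∷ S)                 ≡⟨ sort-∷-sort a (b ∷ S) ⟨
  sortMonomials (a ∷ sortMonomials (b ∷ S)) ∎)
  where open ≡-Reasoning
extendD-comm m@(mvar _)   a b = cong (mD m) (sort-swap b a [])
extendD-comm m@(mlam _)   a b = cong (mD m) (sort-swap b a [])
extendD-comm m@(mapp _ _) a b = cong (mD m) (sort-swap b a [])

module ++-Solver {A : Set} = CommutativeMonoidSolver (++-commutativeMonoid {A = A})
  using (solve; _⊜_) renaming (_⊕_ to _⊞_)

Dₘ-∷-swap : ∀ m x y X → Dₘ m (x ∷ y ∷ X) ↭ Dₘ m (y ∷ x ∷ X)
Dₘ-∷-swap m (i , a) (j , b) X = begin
  (i , ma) ∷ ((j , mb) ∷ (Dₘ m X ++ raise (suc j) (Dₘ mb X)))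
           ++ (suc i + j , mab) ∷ raise (suc i) (Dₘ ma X ++ raise (suc j) (Dₘ mab X))
    ≡⟨ cong (λ Z → (i , ma) ∷ ((j , mb) ∷ (Dₘ m X ++ raise (suc j) (Dₘ mb X)))
                             ++ (suc i + j , mab) ∷ Z)
            (raise-++ (suc i) (Dₘ ma X) _) ⟩
  (i , ma) ∷ ((j , mb) ∷ (Dₘ m X ++ raise (suc j) (Dₘ mb X)))
           ++ (suc i + j , mab) ∷ (raise (suc i) (Dₘ ma X) ++ raise (suc i) (raise (suc j) (Dₘ mab X)))
    ↭⟨ solve 7 (λ ha hb d db hab da dab → ha ⊞ ((hb ⊞ (d ⊞ db)) ⊞ (hab ⊞ (da ⊞ dab)))
                                        ⊜ hb ⊞ ((ha ⊞ (d ⊞ da)) ⊞ (hab ⊞ (db ⊞ dab)))) ↭-refl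
         [ (i , ma) ] [ (j , mb) ] (Dₘ m X) (raise (suc j) (Dₘ mb X)) [ (suc i + j , mab) ]
         (raise (suc i) (Dₘ ma X)) (raise (suc i) (raise (suc j) (Dₘ mab X))) ⟩
  (j , mb) ∷ ((i , ma) ∷ (Dₘ m X ++ raise (suc i) (Dₘ ma X)))
           ++ (suc i + j , mab) ∷ (raise (suc j) (Dₘ mb X) ++ raise (suc i) (raise (suc j) (Dₘ mab X)))
    ≡⟨ cong (λ Z → (j , mb) ∷ ((i , ma) ∷ (Dₘ m X ++ raise (suc i) (Dₘ ma X))) ++ Z) cross-terms ⟩
  Dₘ m ((j , b) ∷ (i , a) ∷ X) ∎
  where
  open Perm.PermutationReasoning
  open ++-Solver
  ma = extendD m a
  mb = extendD m b
  mab = extendD ma b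
  mba = extendD mb a
  cross-terms : (suc i + j , mab) ∷ (raise (suc j) (Dₘ mb X) ++ raise (suc i) (raise (suc j) (Dₘ mab X)))
              ≡ raise (suc j) ((i , mba) ∷ (Dₘ mb X ++ raise (suc i) (Dₘ mba X)))
  cross-terms rewrite extendD-comm m a b =
    cong₂ _∷_ (cong (_, mba) (cong suc (ℕ.+-comm i j)))
      (trans (cong (raise (suc j) (Dₘ mb X) ++_) (raise-comm (suc i) (suc j) (Dₘ mba X)))
             (sym (raise-++ (suc j) (Dₘ mb X) _)))

Dₘ-∷-cong : ∀ x {X Y} → (∀ m → Dₘ m X ↭ Dₘ m Y) → ∀ m → Dₘ m (x ∷ X) ↭ Dₘ m (x ∷ Y)
Dₘ-∷-cong (k , a) X↭Y m = prep _ (++⁺ (X↭Y m) (map⁺ _ (X↭Y (extendD m a))))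

Dₘ⁺ : ∀ {X Y} → X ↭ Y → ∀ m → Dₘ m X ↭ Dₘ m Y
Dₘ⁺ Perm.refl m = ↭-refl
Dₘ⁺ (prep x X↭Y) = Dₘ-∷-cong x (Dₘ⁺ X↭Y)
Dₘ⁺ {x ∷ y ∷ X} {_ ∷ _ ∷ Y} (swap x y X↭Y) m =
  ↭-trans (Dₘ-∷-swap m x y X) (Dₘ-∷-cong y {x ∷ X} {x ∷ Y} (Dₘ-∷-cong x (Dₘ⁺ X↭Y)) m)
Dₘ⁺ (Perm.trans p q) m = ↭-trans (Dₘ⁺ p m) (Dₘ⁺ q m)

extendAll : Monomial → Poly → Poly
extendAll a = map (map₂ (λ m → extendD m a))

raise-extendAll : ∀ j a X → raise j (extendAll a X) ≡ extendAll a (raise j X)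
raise-extendAll j a [] = refl
raise-extendAll j a (_ ∷ X) = cong (_ ∷_) (raise-extendAll j a X)

Dₘ-extendD-comm : ∀ m a B → Dₘ (extendD m a) B ↭ extendAll a (Dₘ m B)
Dₘ-extendD-comm m a [] = ↭-refl
Dₘ-extendD-comm m a ((k , b) ∷ B) rewrite extendD-comm m a b =
  prep _ (begin
    Dₘ ma B ++ raise (suc k) (Dₘ mba B)
      ↭⟨ ++⁺ (Dₘ-extendD-comm m a B) (map⁺ _ (Dₘ-extendD-comm mb a B)) ⟩
    extendAll a (Dₘ m B) ++ raise (suc k) (extendAll a (Dₘ mb B))
      ≡⟨ cong (extendAll a (Dₘ m B) ++_) (raise-extendAll (suc k) a _) ⟩
    extendAll a (Dₘ m B) ++ extendAll a (raise (suc k) (Dₘ mb B))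
      ≡⟨ List.map-++ _ (Dₘ m B) _ ⟨
    extendAll a (Dₘ m B ++ raise (suc k) (Dₘ mb B)) ∎)
  where
  open Perm.PermutationReasoning
  ma = extendD m a
  mb = extendD m b
  mba = extendD mb a

Dₚ-[]ʳ : ∀ X → Dₚ X [] ≡ []
Dₚ-[]ʳ [] = refl
Dₚ-[]ʳ (_ ∷ X) = Dₚ-[]ʳ X

Dₘ-++ : ∀ m A E → Dₘ m (A ++ E) ↭ Dₘ m A ++ Dₘ m E ++ raise 1 (Dₚ (Dₘ m A) E)
Dₘ-++ m [] E = ↭-sym (↭-reflexive (List.++-identityʳ (Dₘ m E)))
Dₘ-++ m ((k , a) ∷ A) E = begin
  (k , ma) ∷ (Dₘ m (A ++ E) ++ raise (suc k) (Dₘ ma (A ++ E)))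
    ↭⟨ prep _ (++⁺ (Dₘ-++ m A E) (map⁺ _ (Dₘ-++ ma A E))) ⟩
  (k , ma) ∷ ((DA ++ DE ++ raise 1 (Dₚ DA E)) ++ raise (suc k) (DaA ++ DaE ++ raise 1 (Dₚ DaA E)))
    ≡⟨ cong (λ Z → (k , ma) ∷ ((DA ++ DE ++ raise 1 (Dₚ DA E)) ++ Z)) raised ⟩
  (k , ma) ∷ ((DA ++ DE ++ raise 1 (Dₚ DA E))
             ++ raise (suc k) DaA ++ raise (suc k) DaE ++ raise 1 (raise (suc k) (Dₚ DaA E)))
    ↭⟨ solve 7 (λ h d e de da dae dade → h ⊞ ((d ⊞ (e ⊞ de)) ⊞ (da ⊞ (dae ⊞ dade)))
                                       ⊜ (h ⊞ (d ⊞ da)) ⊞ (e ⊞ (dae ⊞ (de ⊞ dade)))) ↭-refl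
         [ (k , ma) ] DA DE (raise 1 (Dₚ DA E))
         (raise (suc k) DaA) (raise (suc k) DaE) (raise 1 (raise (suc k) (Dₚ DaA E))) ⟩
  ((k , ma) ∷ (DA ++ raise (suc k) DaA))
    ++ DE ++ raise (suc k) DaE ++ raise 1 (Dₚ DA E) ++ raise 1 (raise (suc k) (Dₚ DaA E))
    ≡⟨ cong (λ Z → ((k , ma) ∷ (DA ++ raise (suc k) DaA)) ++ DE ++ Z) cross-terms ⟩
  Dₘ m ((k , a) ∷ A) ++ DE ++ raise 1 (Dₚ (Dₘ m ((k , a) ∷ A)) E) ∎
  where
  open Perm.PermutationReasoning
  open ++-Solver
  ma = extendD m a
  DA = Dₘ m A
  DE = Dₘ m E
  DaA = Dₘ ma A
  DaE = Dₘ ma E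
  raised : raise (suc k) (DaA ++ DaE ++ raise 1 (Dₚ DaA E))
         ≡ raise (suc k) DaA ++ raise (suc k) DaE ++ raise 1 (raise (suc k) (Dₚ DaA E))
  raised = trans (raise-++ (suc k) DaA _) (cong (raise (suc k) DaA ++_)
             (trans (raise-++ (suc k) DaE _) (cong (raise (suc k) DaE ++_) (raise-comm (suc k) 1 _))))
  cross-terms : raise (suc k) DaE ++ raise 1 (Dₚ DA E) ++ raise 1 (raise (suc k) (Dₚ DaA E))
              ≡ raise 1 (Dₚ (Dₘ m ((k , a) ∷ A)) E)
  cross-terms = sym (trans (raise-++ 1 (raise k DaE) _) (cong₂ _++_ (raise-raise 1 k DaE)
    (trans (cong (raise 1) (trans (linear-++ _ DA _) (cong (Dₚ DA E ++_) (linear-raise _ (suc k) DaA))))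
           (raise-++ 1 (Dₚ DA E) _))))

Dₚ-∷ : ∀ X k a A → Dₚ X ((k , a) ∷ A)
                   ↭ raise k (extendAll a X) ++ Dₚ X A ++ raise (suc k) (Dₚ (extendAll a X) A)
Dₚ-∷ X k a A = begin
  Dₚ X ((k , a) ∷ A)
    ≡⟨ List.concatMap-cong (λ (i , m) → cong ((i + k , extendD m a) ∷_) (raise-++ i (Dₘ m A) _)) X ⟩
  concatMap (λ (i , m) → [ (i + k , extendD m a) ]
                         ++ raise i (Dₘ m A) ++ raise i (raise (suc k) (Dₘ (extendD m a) A))) X
    ↭⟨ concatMap-++-distrib _ _ X ⟩
  concatMap (λ (i , m) → [ (i + k , extendD m a) ]) X
    ++ concatMap (λ (i , m) → raise i (Dₘ m A) ++ raise i (raise (suc k) (Dₘ (extendD m a) A))) X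
    ↭⟨ ++⁺ˡ _ (concatMap-++-distrib _ _ X) ⟩
  concatMap (λ (i , m) → [ (i + k , extendD m a) ]) X ++ Dₚ X A
    ++ linear (raise (suc k) ∘ (λ m → Dₘ (extendD m a) A)) X
    ≡⟨ cong₂ (λ Y Z → Y ++ Dₚ X A ++ Z) (derived-heads X)
             (trans (linear-inner-raise _ (suc k) X)
                    (cong (raise (suc k)) (sym (List.concatMap-map _ _ X)))) ⟩
  raise k (extendAll a X) ++ Dₚ X A ++ raise (suc k) (Dₚ (extendAll a X) A) ∎
  where
  open Perm.PermutationReasoning
  derived-heads : ∀ X → concatMap (λ (i , m) → [ (i + k , extendD m a) ]) X ≡ raise k (extendAll a X)
  derived-heads [] = refl
  derived-heads ((i , m) ∷ X) = cong₂ _∷_ (cong (_, extendD m a) (ℕ.+-comm i k)) (derived-heads X)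

Dₚ-Dₘ-comm : ∀ m A B → Dₚ (Dₘ m A) B ↭ Dₚ (Dₘ m B) A
Dₚ-Dₘ-comm m [] B = ↭-reflexive (sym (Dₚ-[]ʳ (Dₘ m B)))
Dₚ-Dₘ-comm m ((k , a) ∷ A) B = begin
  raise k (Dₘ ma B) ++ Dₚ (Dₘ m A ++ raise (suc k) (Dₘ ma A)) B
    ≡⟨ cong (raise k (Dₘ ma B) ++_)
            (trans (linear-++ _ (Dₘ m A) _) (cong (Dₚ (Dₘ m A) B ++_) (linear-raise _ (suc k) (Dₘ ma A)))) ⟩
  raise k (Dₘ ma B) ++ Dₚ (Dₘ m A) B ++ raise (suc k) (Dₚ (Dₘ ma A) B)
    ↭⟨ ++⁺ (map⁺ _ (Dₘ-extendD-comm m a B)) (++⁺ (Dₚ-Dₘ-comm m A B) (map⁺ _ (begin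
         Dₚ (Dₘ ma A) B                ↭⟨ Dₚ-Dₘ-comm ma A B ⟩
         Dₚ (Dₘ ma B) A                ↭⟨ linear⁺ _ (Dₘ-extendD-comm m a B) ⟩
         Dₚ (extendAll a (Dₘ m B)) A   ∎))) ⟩
  raise k (extendAll a (Dₘ m B)) ++ Dₚ (Dₘ m B) A ++ raise (suc k) (Dₚ (extendAll a (Dₘ m B)) A)
    ↭⟨ Dₚ-∷ (Dₘ m B) k a A ⟨
  Dₚ (Dₘ m B) ((k , a) ∷ A) ∎
  where
  open Perm.PermutationReasoning
  ma = extendD m a

purePart-++-raise : ∀ A E → purePart (A ++ raise 1 E) ≡ purePart A
purePart-++-raise []                E = purePart-raise E
  where
  purePart-raise : ∀ E → purePart (raise 1 E) ≡ []
  purePart-raise [] = refl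
  purePart-raise (_ ∷ E) = purePart-raise E
purePart-++-raise ((zero , m) ∷ A)  E = cong (m ∷_) (purePart-++-raise A E)
purePart-++-raise ((suc _ , _) ∷ A) E = purePart-++-raise A E

εPart-++-raise : ∀ A E → εPart (A ++ raise 1 E) ≡ εPart A ++ E
εPart-++-raise []                E = εPart-raise E
  where
  εPart-raise : ∀ E → εPart (raise 1 E) ≡ E
  εPart-raise [] = refl
  εPart-raise (x ∷ E) = cong (x ∷_) (εPart-raise E)
εPart-++-raise ((zero , _) ∷ A)  E = εPart-++-raise A E
εPart-++-raise ((suc k , m) ∷ A) E = cong ((k , m) ∷_) (εPart-++-raise A E)

applyTo-linear : ∀ P f X → applyTo P (linear f X) ≡ linear (applyTo P ∘ f) X
applyTo-linear P f X = trans (List.map-concatMap _ _ X)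
  (List.concatMap-cong (λ (k , m) → sym (raise-applyTo P k (f m))) X)

appₚ-expand : ∀ X A → let P = sortMonomials (purePart A) in
              appₚ X A ↭ applyTo P X ++ raise 1 (applyTo P (Dₚ X (εPart A)))
appₚ-expand X A = begin
  concatMap (λ (k , m) → [ (k + 0 , mapp m P) ] ++ raise k (raise 1 (applyTo P (Dₘ m (εPart A))))) X
    ↭⟨ concatMap-++-distrib _ _ X ⟩
  concatMap (λ (k , m) → [ (k + 0 , mapp m P) ]) X
    ++ linear (raise 1 ∘ applyTo P ∘ (λ m → Dₘ m (εPart A))) X
    ≡⟨ cong₂ _++_ (heads X)
              (trans (linear-inner-raise _ 1 X) (cong (raise 1) (sym (applyTo-linear P _ X)))) ⟩
  applyTo P X ++ raise 1 (applyTo P (Dₚ X (εPart A))) ∎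
  where
  open Perm.PermutationReasoning
  P = sortMonomials (purePart A)
  heads : ∀ X → concatMap (λ (k , m) → [ (k + 0 , mapp m P) ]) X ≡ applyTo P X
  heads [] = refl
  heads ((k , m) ∷ X) = cong₂ _∷_ (cong (_, mapp m P) (ℕ.+-identityʳ k)) (heads X)

appₘ-taylor : ∀ m A E → appₘ m (A ++ raise 1 E) ↭ appₘ m A ++ raise 1 (appₚ (Dₘ m E) A)
appₘ-taylor m A E rewrite purePart-++-raise A E | εPart-++-raise A E = prep _ (begin
  raise 1 (applyTo P (Dₘ m (εPart A ++ E)))
    ↭⟨ map⁺ _ (map⁺ _ (↭-trans (Dₘ-++ m (εPart A) E)
         (++⁺ˡ (Dₘ m (εPart A)) (++⁺ˡ (Dₘ m E) (map⁺ _ (Dₚ-Dₘ-comm m (εPart A) E)))))) ⟩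
  raise 1 (applyTo P (Dₘ m (εPart A) ++ Dₘ m E ++ raise 1 (Dₚ (Dₘ m E) (εPart A))))
    ≡⟨ distribute ⟩
  raise 1 (applyTo P (Dₘ m (εPart A)))
    ++ raise 1 (applyTo P (Dₘ m E) ++ raise 1 (applyTo P (Dₚ (Dₘ m E) (εPart A))))
    ↭⟨ ++⁺ˡ _ (map⁺ _ (appₚ-expand (Dₘ m E) A)) ⟨
  raise 1 (applyTo P (Dₘ m (εPart A))) ++ raise 1 (appₚ (Dₘ m E) A) ∎)
  where
  open Perm.PermutationReasoning
  P = sortMonomials (purePart A)
  distribute : raise 1 (applyTo P (Dₘ m (εPart A) ++ Dₘ m E ++ raise 1 (Dₚ (Dₘ m E) (εPart A))))
             ≡ raise 1 (applyTo P (Dₘ m (εPart A)))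
               ++ raise 1 (applyTo P (Dₘ m E) ++ raise 1 (applyTo P (Dₚ (Dₘ m E) (εPart A))))
  distribute = trans
    (cong (raise 1) (trans (List.map-++ _ (Dₘ m (εPart A)) _) (cong (applyTo P (Dₘ m (εPart A)) ++_)
      (trans (List.map-++ _ (Dₘ m E) _) (cong (applyTo P (Dₘ m E) ++_) (sym (raise-applyTo P 1 _)))))))
    (raise-++ 1 (applyTo P (Dₘ m (εPart A))) _)

Dₚ-++ʳ : ∀ S T E → Dₚ S (T ++ E) ↭ (Dₚ S T ++ Dₚ S E) ++ raise 1 (Dₚ (Dₚ S T) E)
Dₚ-++ʳ S T E = begin
  Dₚ S (T ++ E)
    ↭⟨ linear-cong-↭ (λ m → Dₘ-++ m T E) S ⟩
  linear (λ m → Dₘ m T ++ Dₘ m E ++ raise 1 (Dₚ (Dₘ m T) E)) S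
    ↭⟨ linear-++-distrib (λ m → Dₘ m T) _ S ⟩
  Dₚ S T ++ linear (λ m → Dₘ m E ++ raise 1 (Dₚ (Dₘ m T) E)) S
    ↭⟨ ++⁺ˡ (Dₚ S T) (linear-++-distrib _ _ S) ⟩
  Dₚ S T ++ Dₚ S E ++ linear (raise 1 ∘ (λ m → Dₚ (Dₘ m T) E)) S
    ≡⟨ cong (λ Z → Dₚ S T ++ Dₚ S E ++ Z)
            (trans (linear-inner-raise _ 1 S) (cong (raise 1) (sym (linear-linear _ _ S)))) ⟩
  Dₚ S T ++ Dₚ S E ++ raise 1 (Dₚ (Dₚ S T) E)
    ≡⟨ List.++-assoc (Dₚ S T) _ _ ⟨
  (Dₚ S T ++ Dₚ S E) ++ raise 1 (Dₚ (Dₚ S T) E) ∎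
  where open Perm.PermutationReasoning

Dₚ-swap : ∀ S T E → Dₚ (Dₚ S T) E ↭ Dₚ (Dₚ S E) T
Dₚ-swap S T E = begin
  Dₚ (Dₚ S T) E                  ≡⟨ linear-linear _ _ S ⟩
  linear (λ m → Dₚ (Dₘ m T) E) S ↭⟨ linear-cong-↭ (λ m → Dₚ-Dₘ-comm m T E) S ⟩
  linear (λ m → Dₚ (Dₘ m E) T) S ≡⟨ linear-linear _ _ S ⟨
  Dₚ (Dₚ S E) T                  ∎
  where open Perm.PermutationReasoning

appₚ-taylor : ∀ S T E → appₚ S (T ++ raise 1 E) ↭ appₚ S T ++ raise 1 (appₚ (Dₚ S E) T)
appₚ-taylor S T E = begin
  appₚ S (T ++ raise 1 E)
    ↭⟨ linear-cong-↭ (λ m → appₘ-taylor m T E) S ⟩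
  linear (λ m → appₘ m T ++ raise 1 (appₚ (Dₘ m E) T)) S
    ↭⟨ linear-++-distrib (λ m → appₘ m T) _ S ⟩
  appₚ S T ++ linear (raise 1 ∘ (λ m → appₚ (Dₘ m E) T)) S
    ≡⟨ cong (appₚ S T ++_) (trans (linear-inner-raise _ 1 S)
                                  (cong (raise 1) (sym (linear-linear (λ m → appₘ m T) _ S)))) ⟩
  appₚ S T ++ raise 1 (appₚ (Dₚ S E) T) ∎
  where open Perm.PermutationReasoning

-- Collapsing ε-powers

-- Collapsible monomials contain a double derivative D(D(s)·t)·e in a
-- position through which ε commutes (λ-bodies, heads of applications, both
-- sides of D); ax-ε2DD then gives ε²m ∼ε εm, so their positive grades are
-- all identified.
mutual
  collapsible : Monomial → Bool
  collapsible (mvar _)   = false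
  collapsible (mlam m)   = collapsible m
  collapsible (mapp m _) = collapsible m
  collapsible (mD h S)   = (1 <ᵇ length S) ∨ collapsible h ∨ anyCollapsible S

  anyCollapsible : List Monomial → Bool
  anyCollapsible []       = false
  anyCollapsible (m ∷ ms) = collapsible m ∨ anyCollapsible ms

isDerivative : Monomial → Bool
isDerivative (mD _ S) = 0 <ᵇ length S
isDerivative _        = false

Collapsible : Monomial → Set
Collapsible m = collapsible m ≡ true

IsDerivative : Monomial → Set
IsDerivative m = isDerivative m ≡ true

AllCollapsible : Poly → Set
AllCollapsible = All (Collapsible ∘ proj₂)

anyCollapsible-↭ : ∀ {ms ms′} → ms ↭ ms′ → anyCollapsible ms ≡ anyCollapsible ms′
anyCollapsible-↭ Perm.refl = refl
anyCollapsible-↭ (prep m p) = cong (collapsible m ∨_) (anyCollapsible-↭ p)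
anyCollapsible-↭ {_ ∷ _ ∷ ms} {_ ∷ _ ∷ ms′} (swap m m′ p) = begin
  collapsible m ∨ collapsible m′ ∨ anyCollapsible ms    ≡⟨ ∨-assoc (collapsible m) _ _ ⟨
  (collapsible m ∨ collapsible m′) ∨ anyCollapsible ms  ≡⟨ cong₂ _∨_ (∨-comm (collapsible m) _)
                                                                    (anyCollapsible-↭ p) ⟩
  (collapsible m′ ∨ collapsible m) ∨ anyCollapsible ms′ ≡⟨ ∨-assoc (collapsible m′) _ _ ⟩
  collapsible m′ ∨ collapsible m ∨ anyCollapsible ms′   ∎
  where open ≡-Reasoning
anyCollapsible-↭ (Perm.trans p q) = trans (anyCollapsible-↭ p) (anyCollapsible-↭ q)

collapsible-extendD-mD : ∀ h S a → collapsible (extendD (mD h S) a)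
                       ≡ (1 <ᵇ suc (length S)) ∨ collapsible h ∨ collapsible a ∨ anyCollapsible S
collapsible-extendD-mD h S a = cong₂ (λ n b → (1 <ᵇ n) ∨ collapsible h ∨ b)
  (↭-length (SortMonomials.sort-↭ (a ∷ S))) (anyCollapsible-↭ (SortMonomials.sort-↭ (a ∷ S)))

extendD-collapsibleʳ : ∀ m a → Collapsible a → Collapsible (extendD m a)
extendD-collapsibleʳ (mD h S) a ca rewrite collapsible-extendD-mD h S a | ca =
  trans (cong ((1 <ᵇ suc (length S)) ∨_) (∨-zeroʳ (collapsible h))) (∨-zeroʳ _)
extendD-collapsibleʳ (mvar _)   a ca rewrite ca = refl
extendD-collapsibleʳ (mlam m)   a ca rewrite ca = ∨-zeroʳ (collapsible m)
extendD-collapsibleʳ (mapp m _) a ca rewrite ca = ∨-zeroʳ (collapsible m)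

extendD-collapsibleˡ : ∀ m a → Collapsible m → Collapsible (extendD m a)
extendD-collapsibleˡ (mD h S) a cm rewrite collapsible-extendD-mD h S a =
  one-more-direction (length S) (collapsible h) (anyCollapsible S) (collapsible a) cm
  where
  one-more-direction : ∀ n b c d → (1 <ᵇ n) ∨ b ∨ c ≡ true → (1 <ᵇ suc n) ∨ b ∨ d ∨ c ≡ true
  one-more-direction (suc n) b     c    d _ = refl
  one-more-direction zero    true  c    d _ = refl
  one-more-direction zero    false true d _ = ∨-zeroʳ d
extendD-collapsibleˡ (mlam m)   a cm rewrite cm = refl
extendD-collapsibleˡ (mapp m _) a cm rewrite cm = refl

extendD-isDerivative : ∀ m a → IsDerivative (extendD m a)
extendD-isDerivative (mD h S)   a rewrite ↭-length (SortMonomials.sort-↭ (a ∷ S)) = refl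
extendD-isDerivative (mvar _)   a = refl
extendD-isDerivative (mlam _)   a = refl
extendD-isDerivative (mapp _ _) a = refl

extendD-derivative-collapsible : ∀ m a → IsDerivative m → Collapsible (extendD m a)
extendD-derivative-collapsible (mD h (b ∷ S)) a _ rewrite collapsible-extendD-mD h (b ∷ S) a = refl

All-linear : ∀ {P Q : Monomial → Set} f {X} → (∀ {m} → Q m → All (P ∘ proj₂) (f m)) →
             All (Q ∘ proj₂) X → All (P ∘ proj₂) (linear f X)
All-linear f fP [] = []
All-linear f fP (q ∷ qs) = All.++⁺ (All.map⁺ (fP q)) (All-linear f fP qs)

Dₘ-allDerivative : ∀ m A → All (IsDerivative ∘ proj₂) (Dₘ m A)
Dₘ-allDerivative m [] = []
Dₘ-allDerivative m ((k , a) ∷ A) =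
  extendD-isDerivative m a ∷ All.++⁺ (Dₘ-allDerivative m A)
                                      (All.map⁺ (Dₘ-allDerivative (extendD m a) A))

Dₘ-derivative-allCollapsible : ∀ m A → IsDerivative m → AllCollapsible (Dₘ m A)
Dₘ-derivative-allCollapsible m [] _ = []
Dₘ-derivative-allCollapsible m ((k , a) ∷ A) dm =
  extendD-derivative-collapsible m a dm ∷ All.++⁺ (Dₘ-derivative-allCollapsible m A dm)
    (All.map⁺ (Dₘ-derivative-allCollapsible (extendD m a) A (extendD-isDerivative m a)))

Dₘ-allCollapsible : ∀ m A → Collapsible m → AllCollapsible (Dₘ m A)
Dₘ-allCollapsible m [] _ = []
Dₘ-allCollapsible m ((k , a) ∷ A) cm =
  extendD-collapsibleˡ m a cm ∷ All.++⁺ (Dₘ-allCollapsible m A cm)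
    (All.map⁺ (Dₘ-derivative-allCollapsible (extendD m a) A (extendD-isDerivative m a)))

appₘ-allCollapsible : ∀ m A → Collapsible m → AllCollapsible (appₘ m A)
appₘ-allCollapsible m A cm = cm ∷ All.map⁺ (All.map⁺ (Dₘ-allCollapsible m (εPart A) cm))

Dₚ-allDerivative : ∀ S T → All (IsDerivative ∘ proj₂) (Dₚ S T)
Dₚ-allDerivative [] T = []
Dₚ-allDerivative ((k , m) ∷ S) T = All.++⁺ (All.map⁺ (Dₘ-allDerivative m T)) (Dₚ-allDerivative S T)

Dₚ-Dₚ-allCollapsible : ∀ S T E → AllCollapsible (Dₚ (Dₚ S T) E)
Dₚ-Dₚ-allCollapsible S T E =
  All-linear _ (λ {m} dm → Dₘ-derivative-allCollapsible m E dm) (Dₚ-allDerivative S T)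

collapseGrade : Bool → ℕ → ℕ
collapseGrade false k       = k
collapseGrade true  zero    = zero
collapseGrade true  (suc _) = 1

collapseᵍ : Graded → Graded
collapseᵍ (k , m) = collapseGrade (collapsible m) k , m

collapse : Poly → Poly
collapse = map collapseᵍ

infix 4 _≃_
_≃_ : Poly → Poly → Set
X ≃ Y = collapse X ↭ collapse Y

infix 4 _≈ᶜ_ _≋ᶜ_
data _≈ᶜ_ : Graded → Graded → Set where
  same      : ∀ {x} → x ≈ᶜ x
  collapsed : ∀ {j k m} → Collapsible m → (suc j , m) ≈ᶜ (suc k , m)

_≋ᶜ_ : Poly → Poly → Set
_≋ᶜ_ = Pointwise _≈ᶜ_

≈ᶜ-sym : ∀ {x y} → x ≈ᶜ y → y ≈ᶜ x
≈ᶜ-sym same = same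
≈ᶜ-sym (collapsed c) = collapsed c

≈ᶜ-trans : ∀ {x y z} → x ≈ᶜ y → y ≈ᶜ z → x ≈ᶜ z
≈ᶜ-trans same q = q
≈ᶜ-trans (collapsed c) same = collapsed c
≈ᶜ-trans (collapsed c) (collapsed _) = collapsed c

≋ᶜ-sym : ∀ {X Y} → X ≋ᶜ Y → Y ≋ᶜ X
≋ᶜ-sym = Pointwise.symmetric ≈ᶜ-sym

≋ᶜ-trans : ∀ {X Y Z} → X ≋ᶜ Y → Y ≋ᶜ Z → X ≋ᶜ Z
≋ᶜ-trans = Pointwise.transitive ≈ᶜ-trans

≋ᶜ-reflexive : ∀ {X Y} → X ≡ Y → X ≋ᶜ Y
≋ᶜ-reflexive refl = Pointwise.refl same

≋ᶜ⇒collapse-≡ : ∀ {X Y} → X ≋ᶜ Y → collapse X ≡ collapse Y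
≋ᶜ⇒collapse-≡ =
  Pointwise.Pointwise-≡⇒≡ ∘ Pointwise.map⁺ collapseᵍ collapseᵍ ∘ Pointwise.map collapseᵍ-≡
  where
  collapseᵍ-≡ : ∀ {x y} → x ≈ᶜ y → collapseᵍ x ≡ collapseᵍ y
  collapseᵍ-≡ same = refl
  collapseᵍ-≡ (collapsed c) rewrite c = refl

≋ᶜ-collapse : ∀ X → X ≋ᶜ collapse X
≋ᶜ-collapse [] = []
≋ᶜ-collapse ((k , m) ∷ X) = collapse-head k (collapsible m) refl ∷ ≋ᶜ-collapse X
  where
  collapse-head : ∀ k b → collapsible m ≡ b → (k , m) ≈ᶜ (collapseGrade b k , m)
  collapse-head k       false _ = same
  collapse-head zero    true  _ = same
  collapse-head (suc k) true  c = collapsed c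

≋ᶜ-raise : ∀ j {X Y} → X ≋ᶜ Y → raise j X ≋ᶜ raise j Y
≋ᶜ-raise j = Pointwise.map⁺ _ _ ∘ Pointwise.map ≈ᶜ-raise
  where
  ≈ᶜ-raise : ∀ {x y} → x ≈ᶜ y → map₁ (j +_) x ≈ᶜ map₁ (j +_) y
  ≈ᶜ-raise same = same
  ≈ᶜ-raise (collapsed {i} {k} c) rewrite ℕ.+-suc j i | ℕ.+-suc j k = collapsed c

raise-suc-≋ᶜ : ∀ i j {Y} → AllCollapsible Y → raise (suc i) Y ≋ᶜ raise (suc j) Y
raise-suc-≋ᶜ i j [] = []
raise-suc-≋ᶜ i j (c ∷ cs) = collapsed c ∷ raise-suc-≋ᶜ i j cs

raise-suc-raise-≋ᶜ : ∀ i j i′ j′ {Y} → AllCollapsible Y →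
                     raise (suc i) (raise j Y) ≋ᶜ raise (suc i′) (raise j′ Y)
raise-suc-raise-≋ᶜ i j i′ j′ [] = []
raise-suc-raise-≋ᶜ i j i′ j′ (c ∷ cs) = collapsed c ∷ raise-suc-raise-≋ᶜ i j i′ j′ cs

≋ᶜ-map₂ : ∀ (g : Monomial → Monomial) → (∀ {m} → Collapsible m → Collapsible (g m)) →
          ∀ {X Y} → X ≋ᶜ Y → map (map₂ g) X ≋ᶜ map (map₂ g) Y
≋ᶜ-map₂ g gC = Pointwise.map⁺ _ _ ∘ Pointwise.map ≈ᶜ-map₂
  where
  ≈ᶜ-map₂ : ∀ {x y} → x ≈ᶜ y → map₂ g x ≈ᶜ map₂ g y
  ≈ᶜ-map₂ same = same
  ≈ᶜ-map₂ (collapsed c) = collapsed (gC c)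

-- The cross terms of Dₘ are derivatives of derivatives, hence collapsible,
-- so only their monomials matter.
≋ᶜ-Dₘ : ∀ {X Y} → X ≋ᶜ Y → ∀ m → Dₘ m X ≋ᶜ Dₘ m Y
≋ᶜ-Dₘ [] m = []
≋ᶜ-Dₘ (_∷_ {x = k , a} same X≋Y) m =
  same ∷ Pointwise.++⁺ (≋ᶜ-Dₘ X≋Y m) (≋ᶜ-raise (suc k) (≋ᶜ-Dₘ X≋Y (extendD m a)))
≋ᶜ-Dₘ {_ ∷ _} {_ ∷ Y} (collapsed {i} {j} {a} c ∷ X≋Y) m =
  collapsed (extendD-collapsibleʳ m a c) ∷ Pointwise.++⁺ (≋ᶜ-Dₘ X≋Y m)
    (≋ᶜ-trans (≋ᶜ-raise (suc (suc i)) (≋ᶜ-Dₘ X≋Y (extendD m a)))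
              (raise-suc-≋ᶜ (suc i) (suc j)
                 (Dₘ-derivative-allCollapsible (extendD m a) Y (extendD-isDerivative m a))))

Dₘ-raise-≋ᶜ : ∀ m X → Dₘ m (raise 1 X) ≋ᶜ raise 1 (Dₘ m X)
Dₘ-raise-≋ᶜ m [] = []
Dₘ-raise-≋ᶜ m ((k , a) ∷ X) = same ∷ ≋ᶜ-trans
  (Pointwise.++⁺ (Dₘ-raise-≋ᶜ m X)
    (≋ᶜ-trans (≋ᶜ-raise (suc (suc k)) (Dₘ-raise-≋ᶜ ma X))
              (raise-suc-raise-≋ᶜ (suc k) 1 0 (suc k)
                 (Dₘ-derivative-allCollapsible ma X (extendD-isDerivative m a)))))
  (≋ᶜ-reflexive (sym (raise-++ 1 (Dₘ m X) _)))
  where ma = extendD m a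

≋ᶜ-linear : ∀ f → (∀ {m} → Collapsible m → AllCollapsible (f m)) →
            ∀ {X Y} → X ≋ᶜ Y → linear f X ≋ᶜ linear f Y
≋ᶜ-linear f fC [] = []
≋ᶜ-linear f fC (same ∷ X≋Y) = Pointwise.++⁺ (Pointwise.refl same) (≋ᶜ-linear f fC X≋Y)
≋ᶜ-linear f fC (collapsed {i} {j} c ∷ X≋Y) = Pointwise.++⁺ (raise-suc-≋ᶜ i j (fC c)) (≋ᶜ-linear f fC X≋Y)

purePart-collapse : ∀ X → purePart (collapse X) ≡ purePart X
purePart-collapse [] = refl
purePart-collapse ((k , m) ∷ X) with collapsible m
purePart-collapse ((zero  , m) ∷ X) | false = cong (m ∷_) (purePart-collapse X)
purePart-collapse ((suc _ , m) ∷ X) | false = purePart-collapse X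
purePart-collapse ((zero  , m) ∷ X) | true  = cong (m ∷_) (purePart-collapse X)
purePart-collapse ((suc _ , m) ∷ X) | true  = purePart-collapse X

εPart-collapse : ∀ X → raise 1 (εPart X) ≋ᶜ raise 1 (εPart (collapse X))
εPart-collapse [] = []
εPart-collapse ((k , m) ∷ X) with collapsible m in c
εPart-collapse ((zero  , m) ∷ X) | false = εPart-collapse X
εPart-collapse ((suc _ , m) ∷ X) | false = same ∷ εPart-collapse X
εPart-collapse ((zero  , m) ∷ X) | true  = εPart-collapse X
εPart-collapse ((suc _ , m) ∷ X) | true  = collapsed c ∷ εPart-collapse X

purePart⁺ : ∀ {X Y} → X ↭ Y → purePart X ↭ purePart Y
purePart⁺ = mapMaybe-≗⁺ pure purePart-mapMaybe
  where
  pure : Graded → Maybe Monomial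
  pure (zero  , m) = just m
  pure (suc _ , _) = nothing
  purePart-mapMaybe : ∀ X → purePart X ≡ mapMaybe pure X
  purePart-mapMaybe [] = refl
  purePart-mapMaybe ((zero  , m) ∷ X) = cong (m ∷_) (purePart-mapMaybe X)
  purePart-mapMaybe ((suc _ , _) ∷ X) = purePart-mapMaybe X

εPart⁺ : ∀ {X Y} → X ↭ Y → εPart X ↭ εPart Y
εPart⁺ = mapMaybe-≗⁺ lower εPart-mapMaybe
  where
  lower : Graded → Maybe Graded
  lower (zero  , _) = nothing
  lower (suc k , m) = just (k , m)
  εPart-mapMaybe : ∀ X → εPart X ≡ mapMaybe lower X
  εPart-mapMaybe [] = refl
  εPart-mapMaybe ((zero  , _) ∷ X) = εPart-mapMaybe X
  εPart-mapMaybe ((suc k , m) ∷ X) = cong ((k , m) ∷_) (εPart-mapMaybe X)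

appₘ⁺ : ∀ {X Y} → X ↭ Y → ∀ m → appₘ m X ↭ appₘ m Y
appₘ⁺ X↭Y m rewrite SortMonomials.↭⇒sort-≡ (purePart⁺ X↭Y) =
  prep _ (map⁺ _ (map⁺ _ (Dₘ⁺ (εPart⁺ X↭Y) m)))

appₘ-≋ᶜ-collapse : ∀ m X → appₘ m X ≋ᶜ appₘ m (collapse X)
appₘ-≋ᶜ-collapse m X rewrite purePart-collapse X = same ∷ positive-part
  where
  P = sortMonomials (purePart X)
  shift-inside : ∀ E → raise 1 (applyTo P (Dₘ m E)) ≋ᶜ applyTo P (Dₘ m (raise 1 E))
  shift-inside E = ≋ᶜ-trans (≋ᶜ-reflexive (raise-applyTo P 1 (Dₘ m E)))
                            (≋ᶜ-map₂ (λ m → mapp m P) (λ c → c) (≋ᶜ-sym (Dₘ-raise-≋ᶜ m E)))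
  positive-part : raise 1 (applyTo P (Dₘ m (εPart X))) ≋ᶜ raise 1 (applyTo P (Dₘ m (εPart (collapse X))))
  positive-part = ≋ᶜ-trans (shift-inside (εPart X))
    (≋ᶜ-trans (≋ᶜ-map₂ (λ m → mapp m P) (λ c → c) (≋ᶜ-Dₘ (εPart-collapse X) m))
              (≋ᶜ-sym (shift-inside (εPart (collapse X)))))

↭⇒≃ : ∀ {X Y} → X ↭ Y → X ≃ Y
↭⇒≃ = map⁺ collapseᵍ

≃-cong : ∀ (F : Poly → Poly) → (∀ X → F X ≋ᶜ F (collapse X)) → (∀ {X Y} → X ↭ Y → F X ↭ F Y) →
         ∀ {X Y} → X ≃ Y → F X ≃ F Y
≃-cong F F-collapse F⁺ {X} {Y} X≃Y = begin
  collapse (F X)            ≡⟨ ≋ᶜ⇒collapse-≡ (F-collapse X) ⟩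
  collapse (F (collapse X)) ↭⟨ ↭⇒≃ (F⁺ X≃Y) ⟩
  collapse (F (collapse Y)) ≡⟨ ≋ᶜ⇒collapse-≡ (F-collapse Y) ⟨
  collapse (F Y)            ∎
  where open Perm.PermutationReasoning

≃-++ : ∀ {X X′ Y Y′} → X ≃ X′ → Y ≃ Y′ → X ++ Y ≃ X′ ++ Y′
≃-++ {X} {X′} {Y} {Y′} X≃X′ Y≃Y′ = begin
  collapse (X ++ Y)             ≡⟨ List.map-++ collapseᵍ X Y ⟩
  collapse X ++ collapse Y      ↭⟨ ++⁺ X≃X′ Y≃Y′ ⟩
  collapse X′ ++ collapse Y′    ≡⟨ List.map-++ collapseᵍ X′ Y′ ⟨
  collapse (X′ ++ Y′)           ∎
  where open Perm.PermutationReasoning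

≃-raise : ∀ j {X Y} → X ≃ Y → raise j X ≃ raise j Y
≃-raise j = ≃-cong (raise j) (≋ᶜ-raise j ∘ ≋ᶜ-collapse) (map⁺ _)

≃-lamₚ : ∀ {X Y} → X ≃ Y → lamₚ X ≃ lamₚ Y
≃-lamₚ = ≃-cong lamₚ (≋ᶜ-map₂ mlam (λ c → c) ∘ ≋ᶜ-collapse) (map⁺ _)

≃-linearˡ : ∀ f → (∀ {m} → Collapsible m → AllCollapsible (f m)) →
            ∀ {X Y} → X ≃ Y → linear f X ≃ linear f Y
≃-linearˡ f fC = ≃-cong (linear f) (≋ᶜ-linear f fC ∘ ≋ᶜ-collapse) (linear⁺ f)

≃-linearʳ : ∀ {f g} → (∀ m → f m ≃ g m) → ∀ X → linear f X ≃ linear g X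
≃-linearʳ f≃g [] = ↭-refl
≃-linearʳ f≃g ((k , m) ∷ X) = ≃-++ (≃-raise k (f≃g m)) (≃-linearʳ f≃g X)

≃-Dₚ : ∀ {S S′ T T′} → S ≃ S′ → T ≃ T′ → Dₚ S T ≃ Dₚ S′ T′
≃-Dₚ {S′ = S′} {T} S≃S′ T≃T′ = ↭-trans
  (≃-linearˡ _ (λ {m} → Dₘ-allCollapsible m T) S≃S′)
  (≃-linearʳ (λ m → ≃-cong (Dₘ m) (λ X → ≋ᶜ-Dₘ (≋ᶜ-collapse X) m) (λ p → Dₘ⁺ p m) T≃T′) S′)

≃-appₚ : ∀ {S S′ T T′} → S ≃ S′ → T ≃ T′ → appₚ S T ≃ appₚ S′ T′
≃-appₚ {S′ = S′} {T} S≃S′ T≃T′ = ↭-trans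
  (≃-linearˡ _ (λ {m} → appₘ-allCollapsible m T) S≃S′)
  (≃-linearʳ (λ m → ≃-cong (appₘ m) (appₘ-≋ᶜ-collapse m) (λ p → appₘ⁺ p m) T≃T′) S′)

Dₚ-raiseʳ : ∀ S T → Dₚ S (raise 1 T) ≃ raise 1 (Dₚ S T)
Dₚ-raiseʳ S T = ↭-trans
  (≃-linearʳ (λ m → ↭-reflexive (≋ᶜ⇒collapse-≡ (Dₘ-raise-≋ᶜ m T))) S)
  (↭-reflexive (cong collapse (linear-inner-raise _ 1 S)))

εε-collapse : ∀ {Y} → AllCollapsible Y → raise 1 (raise 1 Y) ≃ raise 1 Y
εε-collapse {Y} cs = ↭-reflexive (≋ᶜ⇒collapse-≡ (≋ᶜ-trans
  (raise-suc-raise-≋ᶜ 0 1 0 0 cs) (≋ᶜ-reflexive (cong (raise 1) (raise-zero Y)))))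

∼ε⇒≃ : ∀ {s t} → s ∼ε t → ⟦ s ⟧ ≃ ⟦ t ⟧
∼ε⇒≃ ∼refl         = ↭-refl
∼ε⇒≃ (∼sym p)      = ↭-sym (∼ε⇒≃ p)
∼ε⇒≃ (∼trans p q)  = ↭-trans (∼ε⇒≃ p) (∼ε⇒≃ q)
∼ε⇒≃ (c-lam p)     = ≃-lamₚ (∼ε⇒≃ p)
∼ε⇒≃ (c-eps p)     = ≃-raise 1 (∼ε⇒≃ p)
∼ε⇒≃ (c-app p q)   = ≃-appₚ (∼ε⇒≃ p) (∼ε⇒≃ q)
∼ε⇒≃ (c-D p q)     = ≃-Dₚ (∼ε⇒≃ p) (∼ε⇒≃ q)
∼ε⇒≃ (c-+ p q)     = ≃-++ (∼ε⇒≃ p) (∼ε⇒≃ q)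
∼ε⇒≃ (ax-+assoc {s} {t} {e}) = ↭⇒≃ (↭-reflexive (List.++-assoc ⟦ s ⟧ ⟦ t ⟧ ⟦ e ⟧))
∼ε⇒≃ (ax-+0 {s})             = ↭⇒≃ (↭-reflexive (List.++-identityʳ ⟦ s ⟧))
∼ε⇒≃ (ax-+comm {s} {t})      = ↭⇒≃ (++-comm ⟦ s ⟧ ⟦ t ⟧)
∼ε⇒≃ ax-ε0                   = ↭-refl
∼ε⇒≃ (ax-ε+ {s} {t})         = ↭⇒≃ (↭-reflexive (raise-++ 1 ⟦ s ⟧ ⟦ t ⟧))
∼ε⇒≃ ax-λ0                   = ↭-refl
∼ε⇒≃ (ax-λ+ {s} {t})         = ↭⇒≃ (↭-reflexive (List.map-++ _ ⟦ s ⟧ ⟦ t ⟧))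
∼ε⇒≃ (ax-λε {t})             = ↭⇒≃ (↭-reflexive (sym (raise-lamₚ 1 ⟦ t ⟧)))
∼ε⇒≃ ax-app0                 = ↭-refl
∼ε⇒≃ (ax-app+ {s} {t} {e})   = ↭⇒≃ (↭-reflexive (linear-++ (λ m → appₘ m ⟦ e ⟧) ⟦ s ⟧ ⟦ t ⟧))
∼ε⇒≃ (ax-appε {s} {t})       = ↭⇒≃ (↭-reflexive (linear-raise (λ m → appₘ m ⟦ t ⟧) 1 ⟦ s ⟧))
∼ε⇒≃ ax-D0l                  = ↭-refl
∼ε⇒≃ (ax-D+l {s} {t} {e})    = ↭⇒≃ (↭-reflexive (linear-++ (λ m → Dₘ m ⟦ e ⟧) ⟦ s ⟧ ⟦ t ⟧))
∼ε⇒≃ (ax-Dεl {t} {e})        = ↭⇒≃ (↭-reflexive (linear-raise (λ m → Dₘ m ⟦ e ⟧) 1 ⟦ t ⟧))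
∼ε⇒≃ (ax-D0r {s})            = ↭⇒≃ (↭-reflexive (Dₚ-[]ʳ ⟦ s ⟧))
∼ε⇒≃ (ax-D+r {s} {t} {e})    = ↭⇒≃ (Dₚ-++ʳ ⟦ s ⟧ ⟦ t ⟧ ⟦ e ⟧)
∼ε⇒≃ (ax-Dεr {s} {t})        = Dₚ-raiseʳ ⟦ s ⟧ ⟦ t ⟧
∼ε⇒≃ (ax-DDswap {s} {t} {e}) = ↭⇒≃ (Dₚ-swap ⟦ s ⟧ ⟦ t ⟧ ⟦ e ⟧)
∼ε⇒≃ (ax-ε2DD {s} {t} {e})   = εε-collapse (Dₚ-Dₚ-allCollapsible ⟦ s ⟧ ⟦ t ⟧ ⟦ e ⟧)
∼ε⇒≃ (ax-appTaylor {s} {t} {e}) = ↭⇒≃ (appₚ-taylor ⟦ s ⟧ ⟦ t ⟧ ⟦ e ⟧)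

-- Reading normal forms back as terms

infixr 2 _⨾_
_⨾_ : ∀ {s t u} → s ∼ε t → t ∼ε u → s ∼ε u
_⨾_ = ∼trans

≡⇒∼ε : ∀ {s t} → s ≡ t → s ∼ε t
≡⇒∼ε refl = ∼refl

sumOf : (A → Term) → List A → Term
sumOf f []       = 𝟘
sumOf f (x ∷ xs) = f x ⊕ sumOf f xs

sumOf-++ : ∀ (f : A → Term) xs ys → sumOf f (xs ++ ys) ∼ε sumOf f xs ⊕ sumOf f ys
sumOf-++ f [] ys = ∼sym ax-+0 ⨾ ax-+comm
sumOf-++ f (x ∷ xs) ys = c-+ ∼refl (sumOf-++ f xs ys) ⨾ ∼sym ax-+assoc

sumOf-↭ : ∀ (f : A → Term) {xs ys} → xs ↭ ys → sumOf f xs ∼ε sumOf f ys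
sumOf-↭ f Perm.refl = ∼refl
sumOf-↭ f (prep x p) = c-+ ∼refl (sumOf-↭ f p)
sumOf-↭ f (swap x y p) = ∼sym ax-+assoc ⨾ c-+ ax-+comm (sumOf-↭ f p) ⨾ ax-+assoc
sumOf-↭ f (Perm.trans p q) = sumOf-↭ f p ⨾ sumOf-↭ f q

mutual
  reifyₘ : Monomial → Term
  reifyₘ (mvar x)   = var x
  reifyₘ (mlam m)   = lam (reifyₘ m)
  reifyₘ (mapp m P) = app (reifyₘ m) (reifyₘs P)
  reifyₘ (mD h S)   = Dfold (reifyₘ h) S

  reifyₘs : List Monomial → Term
  reifyₘs []       = 𝟘
  reifyₘs (m ∷ ms) = reifyₘ m ⊕ reifyₘs ms

  Dfold : Term → List Monomial → Term
  Dfold t []      = t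
  Dfold t (a ∷ S) = Dfold (D t (reifyₘ a)) S

reifyₘs-sumOf : ∀ ms → reifyₘs ms ≡ sumOf reifyₘ ms
reifyₘs-sumOf [] = refl
reifyₘs-sumOf (m ∷ ms) = cong (reifyₘ m ⊕_) (reifyₘs-sumOf ms)

reifyₘs-↭ : ∀ {ms ms′} → ms ↭ ms′ → reifyₘs ms ∼ε reifyₘs ms′
reifyₘs-↭ {ms} {ms′} p =
  ≡⇒∼ε (reifyₘs-sumOf ms) ⨾ sumOf-↭ reifyₘ p ⨾ ≡⇒∼ε (sym (reifyₘs-sumOf ms′))

reify : Poly → Term
reify = sumOf (λ (k , m) → eps^ k (reifyₘ m))

reify-++ : ∀ X Y → reify (X ++ Y) ∼ε reify X ⊕ reify Y
reify-++ = sumOf-++ _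

reify-↭ : ∀ {X Y} → X ↭ Y → reify X ∼ε reify Y
reify-↭ = sumOf-↭ _

eps^-cong : ∀ k {s t} → s ∼ε t → eps^ k s ∼ε eps^ k t
eps^-cong zero    p = p
eps^-cong (suc k) p = c-eps (eps^-cong k p)

eps^-𝟘 : ∀ k → eps^ k 𝟘 ∼ε 𝟘
eps^-𝟘 zero    = ∼refl
eps^-𝟘 (suc k) = c-eps (eps^-𝟘 k) ⨾ ax-ε0

eps^-⊕ : ∀ k s t → eps^ k (s ⊕ t) ∼ε eps^ k s ⊕ eps^ k t
eps^-⊕ zero    s t = ∼refl
eps^-⊕ (suc k) s t = c-eps (eps^-⊕ k s t) ⨾ ax-ε+

eps^-eps^ : ∀ j k t → eps^ j (eps^ k t) ≡ eps^ (j + k) t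
eps^-eps^ zero    k t = refl
eps^-eps^ (suc j) k t = cong eps (eps^-eps^ j k t)

reify-raise : ∀ j X → reify (raise j X) ∼ε eps^ j (reify X)
reify-raise j [] = ∼sym (eps^-𝟘 j)
reify-raise j ((k , m) ∷ X) =
  c-+ (≡⇒∼ε (sym (eps^-eps^ j k (reifyₘ m)))) (reify-raise j X) ⨾ ∼sym (eps^-⊕ j _ _)

εIdempotent : Term → Set
εIdempotent t = eps (eps t) ∼ε eps t

record CommutesWithε (F : Term → Term) : Set where
  field
    F-cong : ∀ {s t} → s ∼ε t → F s ∼ε F t
    F-eps  : ∀ t → F (eps t) ∼ε eps (F t)

  F-eps^ : ∀ k t → F (eps^ k t) ∼ε eps^ k (F t)
  F-eps^ zero    t = ∼refl
  F-eps^ (suc k) t = F-eps (eps^ k t) ⨾ c-eps (F-eps^ k t)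

  F-εIdempotent : ∀ {t} → εIdempotent t → εIdempotent (F t)
  F-εIdempotent {t} εε≈ε = ∼sym (F-eps^ 2 t) ⨾ F-cong εε≈ε ⨾ F-eps t

lam-commutesWithε : CommutesWithε lam
lam-commutesWithε = record { F-cong = c-lam ; F-eps = λ _ → ax-λε }

appˡ-commutesWithε : ∀ u → CommutesWithε (λ s → app s u)
appˡ-commutesWithε u = record { F-cong = λ p → c-app p ∼refl ; F-eps = λ _ → ax-appε }

Dˡ-commutesWithε : ∀ u → CommutesWithε (λ s → D s u)
Dˡ-commutesWithε u = record { F-cong = λ p → c-D p ∼refl ; F-eps = λ _ → ax-Dεl }

Dʳ-commutesWithε : ∀ s → CommutesWithε (D s)
Dʳ-commutesWithε s = record { F-cong = c-D ∼refl ; F-eps = λ _ → ax-Dεr }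

record IsLinear (F : Term → Term) : Set where
  field
    commutesWithε : CommutesWithε F
    F-𝟘 : F 𝟘 ∼ε 𝟘
    F-⊕ : ∀ s t → F (s ⊕ t) ∼ε F s ⊕ F t

  open CommutesWithε commutesWithε public

  reify-linear : ∀ f → (∀ m → F (reifyₘ m) ∼ε reify (f m)) →
                 ∀ X → F (reify X) ∼ε reify (linear f X)
  reify-linear f F-f [] = F-𝟘
  reify-linear f F-f ((k , m) ∷ X) =
    F-⊕ _ _ ⨾ c-+ (F-eps^ k (reifyₘ m) ⨾ eps^-cong k (F-f m) ⨾ ∼sym (reify-raise k (f m)))
                  (reify-linear f F-f X)
    ⨾ ∼sym (reify-++ (raise k (f m)) _)

appˡ-isLinear : ∀ u → IsLinear (λ s → app s u)
appˡ-isLinear u = record { commutesWithε = appˡ-commutesWithε u ; F-𝟘 = ax-app0 ; F-⊕ = λ _ _ → ax-app+ }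

Dˡ-isLinear : ∀ u → IsLinear (λ s → D s u)
Dˡ-isLinear u = record { commutesWithε = Dˡ-commutesWithε u ; F-𝟘 = ax-D0l ; F-⊕ = λ _ _ → ax-D+l }

open CommutesWithε using (F-eps^; F-εIdempotent)
open IsLinear using (reify-linear)

reify-lamₚ : ∀ X → lam (reify X) ∼ε reify (lamₚ X)
reify-lamₚ [] = ax-λ0
reify-lamₚ ((k , m) ∷ X) = ax-λ+ ⨾ c-+ (F-eps^ lam-commutesWithε k (reifyₘ m)) (reify-lamₚ X)

reify-applyTo : ∀ P Y → app (reify Y) (reifyₘs P) ∼ε reify (applyTo P Y)
reify-applyTo P [] = ax-app0
reify-applyTo P ((k , m) ∷ Y) =
  ax-app+ ⨾ c-+ (F-eps^ (appˡ-commutesWithε _) k (reifyₘ m)) (reify-applyTo P Y)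

Dfold-cong : ∀ S {t t′} → t ∼ε t′ → Dfold t S ∼ε Dfold t′ S
Dfold-cong []      p = p
Dfold-cong (a ∷ S) p = Dfold-cong S (c-D p ∼refl)

Dfold-↭ : ∀ t {S S′} → S ↭ S′ → Dfold t S ∼ε Dfold t S′
Dfold-↭ t Perm.refl = ∼refl
Dfold-↭ t (prep a p) = Dfold-↭ (D t (reifyₘ a)) p
Dfold-↭ t {a ∷ b ∷ S} (swap a b p) = Dfold-cong S ax-DDswap ⨾ Dfold-↭ _ p
Dfold-↭ t (Perm.trans p q) = Dfold-↭ t p ⨾ Dfold-↭ t q

Dfold-∷ʳ : ∀ t S a → Dfold t (S ++ [ a ]) ≡ D (Dfold t S) (reifyₘ a)
Dfold-∷ʳ t []      a = refl
Dfold-∷ʳ t (b ∷ S) a = Dfold-∷ʳ (D t (reifyₘ b)) S a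

extendD-sound : ∀ m a → D (reifyₘ m) (reifyₘ a) ∼ε reifyₘ (extendD m a)
extendD-sound (mD h S) a = ≡⇒∼ε (sym (Dfold-∷ʳ (reifyₘ h) S a)) ⨾ Dfold-↭ (reifyₘ h)
  (↭-trans (↭-sym (∷↭∷ʳ a S)) (↭-sym (SortMonomials.sort-↭ (a ∷ S))))
extendD-sound (mvar _)   a = ∼refl
extendD-sound (mlam _)   a = ∼refl
extendD-sound (mapp _ _) a = ∼refl

Dₘ-sound : ∀ m A → D (reifyₘ m) (reify A) ∼ε reify (Dₘ m A)
Dₘ-sound m [] = ax-D0r
Dₘ-sound m ((k , a) ∷ A) =
  ax-D+r ⨾ c-+ (c-+ D-summand (Dₘ-sound m A))
               (c-eps (c-D D-summand ∼refl ⨾ F-eps^ (Dˡ-commutesWithε _) k _ ⨾ eps^-cong k (Dₘ-sound ma A))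
                ⨾ ∼sym (reify-raise (suc k) (Dₘ ma A)))
  ⨾ ax-+assoc ⨾ c-+ ∼refl (∼sym (reify-++ (Dₘ m A) _))
  where
  ma = extendD m a
  D-summand : D (reifyₘ m) (eps^ k (reifyₘ a)) ∼ε eps^ k (reifyₘ ma)
  D-summand = F-eps^ (Dʳ-commutesWithε _) k _ ⨾ eps^-cong k (extendD-sound m a)

reify-purePart-εPart : ∀ A → reify A ∼ε reifyₘs (purePart A) ⊕ eps (reify (εPart A))
reify-purePart-εPart [] = ∼sym (c-+ ∼refl ax-ε0 ⨾ ax-+0)
reify-purePart-εPart ((zero , a) ∷ A) = c-+ ∼refl (reify-purePart-εPart A) ⨾ ∼sym ax-+assoc
reify-purePart-εPart ((suc k , a) ∷ A) =
  c-+ ∼refl (reify-purePart-εPart A) ⨾ ∼sym ax-+assoc ⨾ c-+ ax-+comm ∼refl ⨾ ax-+assoc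
  ⨾ c-+ ∼refl (∼sym ax-ε+)

appₘ-sound : ∀ m A → app (reifyₘ m) (reify A) ∼ε reify (appₘ m A)
appₘ-sound m A =
  c-app ∼refl (reify-purePart-εPart A ⨾ c-+ (reifyₘs-↭ (↭-sym (SortMonomials.sort-↭ (purePart A)))) ∼refl)
  ⨾ ax-appTaylor
  ⨾ c-+ ∼refl (c-eps (c-app (Dₘ-sound m (εPart A)) ∼refl ⨾ reify-applyTo P (Dₘ m (εPart A)))
               ⨾ ∼sym (reify-raise 1 _))
  where P = sortMonomials (purePart A)

⟦⟧-sound : ∀ t → t ∼ε reify ⟦ t ⟧
⟦⟧-sound (var x)   = ∼sym ax-+0
⟦⟧-sound (lam t)   = c-lam (⟦⟧-sound t) ⨾ reify-lamₚ ⟦ t ⟧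
⟦⟧-sound (app s t) = c-app (⟦⟧-sound s) (⟦⟧-sound t)
  ⨾ reify-linear (appˡ-isLinear _) _ (λ m → appₘ-sound m ⟦ t ⟧) ⟦ s ⟧
⟦⟧-sound (D s t)   = c-D (⟦⟧-sound s) (⟦⟧-sound t)
  ⨾ reify-linear (Dˡ-isLinear _) _ (λ m → Dₘ-sound m ⟦ t ⟧) ⟦ s ⟧
⟦⟧-sound (eps t)   = c-eps (⟦⟧-sound t) ⨾ ∼sym (reify-raise 1 ⟦ t ⟧)
⟦⟧-sound (s ⊕ t)   = c-+ (⟦⟧-sound s) (⟦⟧-sound t) ⨾ ∼sym (reify-++ ⟦ s ⟧ ⟦ t ⟧)
⟦⟧-sound 𝟘         = ∼refl

Dfold-εIdempotent : ∀ S {t} → εIdempotent t → εIdempotent (Dfold t S)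
Dfold-εIdempotent []      p = p
Dfold-εIdempotent (a ∷ S) p = Dfold-εIdempotent S (F-εIdempotent (Dˡ-commutesWithε _) p)

collapsible-εIdempotent : ∀ m → Collapsible m → εIdempotent (reifyₘ m)
collapsible-εIdempotent (mlam m)   c = F-εIdempotent lam-commutesWithε (collapsible-εIdempotent m c)
collapsible-εIdempotent (mapp m P) c = F-εIdempotent (appˡ-commutesWithε _) (collapsible-εIdempotent m c)
collapsible-εIdempotent (mD h (a ∷ b ∷ S)) _ = Dfold-εIdempotent S ax-ε2DD
collapsible-εIdempotent (mD h []) c with collapsible h in ch
... | true = collapsible-εIdempotent h ch
collapsible-εIdempotent (mD h (a ∷ [])) c with collapsible h in ch | collapsible a in ca
... | true  | _    = F-εIdempotent (Dˡ-commutesWithε _) (collapsible-εIdempotent h ch)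
... | false | true = F-εIdempotent (Dʳ-commutesWithε _) (collapsible-εIdempotent a ca)

reify-collapse : ∀ X → reify (collapse X) ∼ε reify X
reify-collapse [] = ∼refl
reify-collapse ((k , m) ∷ X) = c-+ (collapsed-grade k (collapsible m) refl) (reify-collapse X)
  where
  εⁿ-collapse : ∀ k → Collapsible m → eps^ (suc k) (reifyₘ m) ∼ε eps (reifyₘ m)
  εⁿ-collapse zero    c = ∼refl
  εⁿ-collapse (suc k) c = c-eps (εⁿ-collapse k c) ⨾ collapsible-εIdempotent m c
  collapsed-grade : ∀ k b → collapsible m ≡ b → eps^ (collapseGrade b k) (reifyₘ m) ∼ε eps^ k (reifyₘ m)
  collapsed-grade k       false _ = ∼refl
  collapsed-grade zero    true  _ = ∼refl
  collapsed-grade (suc k) true  c = ∼sym (εⁿ-collapse k c)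

normalForm : Term → Poly
normalForm t = SortGraded.sort (collapse ⟦ t ⟧)

normalForm-sound : ∀ t → t ∼ε reify (normalForm t)
normalForm-sound t =
  ⟦⟧-sound t ⨾ ∼sym (reify-collapse ⟦ t ⟧) ⨾ reify-↭ (↭-sym (SortGraded.sort-↭ (collapse ⟦ t ⟧)))

normalForm-complete : ∀ {s t} → s ∼ε t → normalForm s ≡ normalForm t
normalForm-complete = SortGraded.↭⇒sort-≡ ∘ ∼ε⇒≃

mainTheorem1 : (s t : Term) → Dec (s ∼ε t)
mainTheorem1 s t = map′ (λ eq → normalForm-sound s ⨾ ≡⇒∼ε (cong reify eq) ⨾ ∼sym (normalForm-sound t))
                        normalForm-complete
                        (List.≡-dec SortGraded._≟_ (normalForm s) (normalForm t))
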